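{- Let $k\ge1$, $0\le j\le k-1$ be integers and $t\in\mathbb{Z}$. Then $$\sum_{\eta\in\Delta_k}\frac{\eta^{t}}{(1-\eta)(1-\eta^2)\cdots(1-\eta^{j})}=\frac{1}{k}\,\sigma_k(t;k-1-j).$$
   Context: $\Delta_k$ is the set of primitive $k$-th roots of unity; $(q)_n=\prod_{i=1}^n(1-q^i)$ for $n\ge1$, $(q)_0=1$ (an empty product equals $1$). For $0\le j<k$ and $t\in\mathbb{Z}$, $\sigma_k(t;j)=\sum_{\xi\in\Delta_k}\xi^{ -t}(\xi)_j$ (the Gaussian–Ramanujan sum). -}

module Defs where

open import Level using (Level; _⊔_; suc)
open import Algebra.Bundles using (CommutativeRing)
open import Data.Nat using (ℕ; zero; _<_) renaming (suc to sucℕ)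
open import Data.Nat.Coprimality using (coprime?)
open import Data.Integer using (ℤ; +_; -[1+_])
import Data.Integer
open import Data.List using (List; []; _∷_; map; filter; upTo)
open import Data.Product using (_×_)
open import Relation.Nullary using (¬_)

module RingOps {c ℓ : Level} (R : CommutativeRing c ℓ) where
  open CommutativeRing R

  pow : Carrier → ℕ → Carrier
  pow x zero = 1#
  pow x (sucℕ n) = x * pow x n

  fromℕ : ℕ → Carrier
  fromℕ zero = 0#
  fromℕ (sucℕ n) = 1# + fromℕ n

-- A field of characteristic 0, presented as a commutative ring with a total
-- inverse operation (x⁻¹ is only constrained for x ≉ 0).
record Char0Field (c ℓ : Level) : Set (suc (c ⊔ ℓ)) where
  field
    ring : CommutativeRing c ℓ
  open CommutativeRing ring using (Carrier; _≈_; _*_; 0#; 1#)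
  field
    _⁻¹     : Carrier → Carrier
    ⁻¹-cong : ∀ {x y} → x ≈ y → (x ⁻¹) ≈ (y ⁻¹)
    inverse : ∀ x → ¬ (x ≈ 0#) → (x * (x ⁻¹)) ≈ 1#
    1≉0     : ¬ (1# ≈ 0#)
    char0   : ∀ n → ¬ (RingOps.fromℕ ring (sucℕ n) ≈ 0#)

module FieldOps {c ℓ : Level} (F : Char0Field c ℓ) where
  open Char0Field F public
  open CommutativeRing ring public hiding (ring)
  open RingOps ring public

  powℤ : Carrier → ℤ → Carrier
  powℤ x (+ n) = pow x n
  powℤ x -[1+ n ] = pow (x ⁻¹) (sucℕ n)

  sumL : List Carrier → Carrier
  sumL [] = 0#
  sumL (x ∷ xs) = x + sumL xs

  poch : Carrier → ℕ → Carrier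
  poch q zero = 1#
  poch q (sucℕ n) = poch q n * (1# - pow q (sucℕ n))

  IsPrimitiveRoot : ℕ → Carrier → Set ℓ
  IsPrimitiveRoot k ζ = (pow ζ k ≈ 1#) × (∀ m → 0 < m → m < k → ¬ (pow ζ m ≈ 1#))

  -- exponents a ∈ {1,…,k} with gcd(a,k) = 1; for primitive ζ, {ζ^a} is exactly Δ_k
  primExps : ℕ → List ℕ
  primExps k = filter (λ a → coprime? a k) (map sucℕ (upTo k))

  sumΔ : ℕ → Carrier → (Carrier → Carrier) → Carrier
  sumΔ k ζ f = sumL (map (λ a → f (pow ζ a)) (primExps k))

  σ : ℕ → Carrier → ℤ → ℕ → Carrier
  σ k ζ t j = sumΔ k ζ (λ ξ → powℤ ξ (Data.Integer.- t) * poch ξ j)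

-- For a primitive k-th root of unity η, the polynomial 1 + x + ⋯ + x^(k-1) has the
-- k - 1 distinct roots η, η², …, η^(k-1), so it equals ∏ᵢ (x - ηⁱ); evaluating at
-- x = 1 gives (η)_(k-1) = k.  Splitting this product at j and using ηⁱ = (η⁻¹)^(k-i)
-- gives (η)_(k-1) = (η)_j · (η⁻¹)_(k-1-j), hence ηᵗ / (η)_j = (η⁻¹)^(-t) (η⁻¹)_(k-1-j) / k.
-- Summing over Δ_k, which is closed under η ↦ η⁻¹, yields the theorem.
module Submission where

open import Defs
open import Level using (Level)
open import Algebra.Bundles using (CommutativeRing)
import Algebra.Properties.Ring as RingProperties
import Algebra.Properties.CommutativeSemiring.Exp as Exp
open import Tactic.RingSolver.Core.AlmostCommutativeRing
  using (AlmostCommutativeRing; fromCommutativeRing)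
open import Tactic.RingSolver using (solve-∀)
open import Data.Maybe using (nothing)
open import Data.Nat using (ℕ; zero; suc; _≤_; _<_; _∸_; z≤n; s≤s; z<s; NonZero; >-nonZero)
import Data.Nat as ℕ
import Data.Nat.Properties as ℕ
open import Data.Nat.DivMod using (_%_; _/_; m≡m%n+[m/n]*n; m%n<n)
open import Data.Nat.Divisibility using (_∣_; ∣⇒≤; ∣m+n∣m⇒∣n; m%n≡0⇒n∣m)
open import Data.Nat.Coprimality using (Coprime; coprime?; coprime-divisor)
import Data.Nat.Coprimality as Coprime
open import Data.Integer using (ℤ)
import Data.Integer as ℤ
open import Data.List using ([]; _∷_; map; filter; applyUpTo; upTo)
import Data.List.Properties as List
open import Data.Vec using (Vec; []; _∷_; replicate)
open import Data.Product using (_×_; _,_; proj₁; proj₂)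
open import Data.Empty using (⊥-elim)
open import Relation.Nullary using (¬_; Dec; yes; no)
open import Relation.Unary using (Pred; Decidable)
open import Relation.Binary.PropositionalEquality as ≡ using (_≡_)

-- Stated with x - c as an atom d and with 1# abstracted as o: with no zero test for
-- coefficients, the solver only proves identities needing no cancellation.
module RingIdentities {c ℓ : Level} (R : CommutativeRing c ℓ) where
  private
    A : AlmostCommutativeRing c ℓ
    A = fromCommutativeRing R (λ _ → nothing)
  open AlmostCommutativeRing A

  linear-division-base : ∀ a d c → a + (d + c) ≈ d + (a + c)
  linear-division-base = solve-∀ A

  linear-division-step : ∀ a d c q r → a + (d + c) * (d * q + r) ≈ d * (r + (d + c) * q) + (a + c * r)
  linear-division-step = solve-∀ A

  geometric-base : ∀ y o → o * y + o ≈ o + y * o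
  geometric-base = solve-∀ A

  geometric-step₁ : ∀ y e o → (o + y * e) * y + o ≈ o + y * (e * y + o)
  geometric-step₁ = solve-∀ A

  geometric-step₂ : ∀ y e p o → o + y * (e + p) ≈ (o + y * e) + y * p
  geometric-step₂ = solve-∀ A

module Cyclotomic {c ℓ : Level} (F : Char0Field c ℓ) where
  open FieldOps F
  open RingIdentities ring
  open RingProperties (CommutativeRing.ring ring) using (x∙y⁻¹≈ε⇒x≈y; x≈y⇒x∙y⁻¹≈ε; //-rightDividesˡ; +-cancelˡ; +-cancelʳ; x[y-z]≈xy-xz)
  open Exp commutativeSemiring using (_^_; ^-congˡ; ^-homo-*; ^-assocʳ; ^-distrib-*)
  open import Relation.Binary.Reasoning.Setoid setoid

  private variable
    x y z η η′ ζ : Carrier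
    a i j k m n K : ℕ

  *≈1⇒≉0 : x * y ≈ 1# → ¬ x ≈ 0#
  *≈1⇒≉0 {x} {y} xy≈1 x≈0 = 1≉0 (begin
    1#     ≈⟨ xy≈1 ⟨
    x * y  ≈⟨ *-congʳ x≈0 ⟩
    0# * y ≈⟨ zeroˡ y ⟩
    0#     ∎)

  ⁻¹*-cancel : ¬ x ≈ 0# → ∀ y → x ⁻¹ * (x * y) ≈ y
  ⁻¹*-cancel {x} x≉0 y = begin
    x ⁻¹ * (x * y) ≈⟨ *-assoc _ _ _ ⟨
    x ⁻¹ * x * y   ≈⟨ *-congʳ (trans (*-comm _ _) (inverse x x≉0)) ⟩
    1# * y         ≈⟨ *-identityˡ y ⟩
    y              ∎

  *-cancelˡ : ¬ x ≈ 0# → x * y ≈ x * z → y ≈ z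
  *-cancelˡ {x} {y} {z} x≉0 xy≈xz =
    trans (sym (⁻¹*-cancel x≉0 y)) (trans (*-congˡ xy≈xz) (⁻¹*-cancel x≉0 z))

  *≈0⇒≈0 : ¬ x ≈ 0# → x * y ≈ 0# → y ≈ 0#
  *≈0⇒≈0 {x} x≉0 xy≈0 = *-cancelˡ x≉0 (trans xy≈0 (sym (zeroʳ x)))

  ⁻¹-unique : x * y ≈ 1# → x ⁻¹ ≈ y
  ⁻¹-unique {x} xy≈1 = *-cancelˡ (*≈1⇒≉0 xy≈1) (trans (inverse x (*≈1⇒≉0 xy≈1)) (sym xy≈1))

  ⁻¹-involutive : ¬ x ≈ 0# → (x ⁻¹) ⁻¹ ≈ x
  ⁻¹-involutive {x} x≉0 = ⁻¹-unique (trans (*-comm _ _) (inverse x x≉0))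

  -≉0 : ¬ x ≈ y → ¬ x - y ≈ 0#
  -≉0 {x} {y} x≉y x-y≈0 = x≉y (x∙y⁻¹≈ε⇒x≈y x y x-y≈0)

  pow≡^ : ∀ x n → pow x n ≡ x ^ n
  pow≡^ x zero    = ≡.refl
  pow≡^ x (suc n) = ≡.cong (x *_) (pow≡^ x n)

  pow-cong : ∀ n → x ≈ y → pow x n ≈ pow y n
  pow-cong {x} {y} n x≈y rewrite pow≡^ x n | pow≡^ y n = ^-congˡ n x≈y

  pow-+ : ∀ x m n → pow x (m ℕ.+ n) ≈ pow x m * pow x n
  pow-+ x m n rewrite pow≡^ x (m ℕ.+ n) | pow≡^ x m | pow≡^ x n = ^-homo-* x m n

  pow-* : ∀ x m n → pow (pow x m) n ≈ pow x (m ℕ.* n)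
  pow-* x m n rewrite pow≡^ (pow x m) n | pow≡^ x m | pow≡^ x (m ℕ.* n) = ^-assocʳ x m n

  pow-distrib-* : ∀ x y n → pow (x * y) n ≈ pow x n * pow y n
  pow-distrib-* x y n rewrite pow≡^ (x * y) n | pow≡^ x n | pow≡^ y n = ^-distrib-* x y n

  pow-1# : ∀ n → pow 1# n ≈ 1#
  pow-1# zero    = refl
  pow-1# (suc n) = trans (*-identityˡ _) (pow-1# n)

  powℤ-cong : ∀ t → x ≈ y → powℤ x t ≈ powℤ y t
  powℤ-cong (ℤ.+ n)    x≈y = pow-cong n x≈y
  powℤ-cong ℤ.-[1+ n ] x≈y = pow-cong (suc n) (⁻¹-cong x≈y)

  powℤ-⁻¹ : ¬ x ≈ 0# → ∀ t → powℤ x t ≈ powℤ (x ⁻¹) (ℤ.- t)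
  powℤ-⁻¹ x≉0 (ℤ.+ zero)  = refl
  powℤ-⁻¹ x≉0 (ℤ.+ suc n) = pow-cong (suc n) (sym (⁻¹-involutive x≉0))
  powℤ-⁻¹ x≉0 ℤ.-[1+ n ]  = refl

  poch-cong : ∀ n → x ≈ y → poch x n ≈ poch y n
  poch-cong zero    x≈y = refl
  poch-cong (suc n) x≈y = *-cong (poch-cong n x≈y) (+-congˡ (-‿cong (pow-cong (suc n) x≈y)))

  -- Roots of unity

  root-pow-multiple : pow ζ k ≈ 1# → ∀ q → pow ζ (q ℕ.* k) ≈ 1#
  root-pow-multiple {ζ} {k} ζᵏ≈1 q = begin
    pow ζ (q ℕ.* k)  ≡⟨ ≡.cong (pow ζ) (ℕ.*-comm q k) ⟩
    pow ζ (k ℕ.* q)  ≈⟨ pow-* ζ k q ⟨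
    pow (pow ζ k) q  ≈⟨ pow-cong q ζᵏ≈1 ⟩
    pow 1# q         ≈⟨ pow-1# q ⟩
    1#               ∎

  root-pow : pow ζ k ≈ 1# → ∀ a → pow (pow ζ a) k ≈ 1#
  root-pow {ζ} {k} ζᵏ≈1 a = trans (pow-* ζ a k) (root-pow-multiple {k = k} ζᵏ≈1 a)

  root-pow-complement : pow ζ k ≈ 1# → a ≤ k → pow ζ a * pow ζ (k ∸ a) ≈ 1#
  root-pow-complement {ζ} {k} {a} ζᵏ≈1 a≤k = begin
    pow ζ a * pow ζ (k ∸ a)  ≈⟨ pow-+ ζ a (k ∸ a) ⟨
    pow ζ (a ℕ.+ (k ∸ a))    ≡⟨ ≡.cong (pow ζ) (ℕ.m+[n∸m]≡n a≤k) ⟩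
    pow ζ k                  ≈⟨ ζᵏ≈1 ⟩
    1#                       ∎

  root-pow-% : .{{_ : NonZero k}} → pow ζ k ≈ 1# → ∀ n → pow ζ n ≈ pow ζ (n % k)
  root-pow-% {k} {ζ} ζᵏ≈1 n = begin
    pow ζ n                                ≡⟨ ≡.cong (pow ζ) (m≡m%n+[m/n]*n n k) ⟩
    pow ζ (n % k ℕ.+ (n / k) ℕ.* k)        ≈⟨ pow-+ ζ (n % k) _ ⟩
    pow ζ (n % k) * pow ζ ((n / k) ℕ.* k)  ≈⟨ *-congˡ (root-pow-multiple ζᵏ≈1 (n / k)) ⟩
    pow ζ (n % k) * 1#                     ≈⟨ *-identityʳ _ ⟩
    pow ζ (n % k)                          ∎

  primitive-order : .{{_ : NonZero k}} → IsPrimitiveRoot k ζ → pow ζ n ≈ 1# → k ∣ n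
  primitive-order {k} {ζ} {n} (ζᵏ≈1 , minimal) ζⁿ≈1 with n % k in n%k≡r
  ... | zero  = m%n≡0⇒n∣m n k n%k≡r
  ... | suc r = ⊥-elim (minimal (suc r) z<s (≡.subst (_< k) n%k≡r (m%n<n n k)) ζ¹⁺ʳ≈1)
    where
    ζ¹⁺ʳ≈1 : pow ζ (suc r) ≈ 1#
    ζ¹⁺ʳ≈1 = trans (sym (trans (root-pow-% ζᵏ≈1 n) (reflexive (≡.cong (pow ζ) n%k≡r)))) ζⁿ≈1

  coprime-pow-primitive : .{{_ : NonZero k}} → IsPrimitiveRoot k ζ → Coprime a k →
                          IsPrimitiveRoot k (pow ζ a)
  coprime-pow-primitive {k} {ζ} {a} ζ-prim a⊥k = root-pow {k = k} (proj₁ ζ-prim) a , not-earlier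
    where
    not-earlier : ∀ m → 0 < m → m < k → ¬ pow (pow ζ a) m ≈ 1#
    not-earlier m 0<m m<k ζᵃᵐ≈1 = ℕ.<⇒≱ m<k (∣⇒≤ {{>-nonZero 0<m}} k∣m)
      where
      k∣m : k ∣ m
      k∣m = coprime-divisor (Coprime.sym a⊥k)
              (primitive-order ζ-prim (trans (sym (pow-* ζ a m)) ζᵃᵐ≈1))

  primitive-pow-injective : IsPrimitiveRoot k η → i < j → j < k → ¬ pow η i ≈ pow η j
  primitive-pow-injective {k} {η} {i} {j} (ηᵏ≈1 , minimal) i<j j<k ηⁱ≈ηʲ =
    minimal (j ∸ i) (ℕ.m<n⇒0<n∸m i<j) (ℕ.≤-<-trans (ℕ.m∸n≤m j i) j<k) ηʲ⁻ⁱ≈1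
    where
    ηʲ⁻ⁱ≈1 : pow η (j ∸ i) ≈ 1#
    ηʲ⁻ⁱ≈1 = *-cancelˡ (*≈1⇒≉0 (root-pow-complement ηᵏ≈1 (ℕ.<⇒≤ (ℕ.<-trans i<j j<k)))) (begin
      pow η i * pow η (j ∸ i)  ≈⟨ pow-+ η i (j ∸ i) ⟨
      pow η (i ℕ.+ (j ∸ i))    ≡⟨ ≡.cong (pow η) (ℕ.m+[n∸m]≡n (ℕ.<⇒≤ i<j)) ⟩
      pow η j                  ≈⟨ ηⁱ≈ηʲ ⟨
      pow η i                  ≈⟨ *-identityʳ _ ⟨
      pow η i * 1#             ∎)

  ∏< : ℕ → (ℕ → Carrier) → Carrier
  ∏< zero    φ = 1#
  ∏< (suc n) φ = ∏< n φ * φ n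

  poch≡∏< : ∀ x n → poch x n ≡ ∏< n (λ i → 1# - pow x (suc i))
  poch≡∏< x zero    = ≡.refl
  poch≡∏< x (suc n) = ≡.cong (_* (1# - pow x (suc n))) (poch≡∏< x n)

  Σ< : ℕ → (ℕ → Carrier) → Carrier
  Σ< zero    φ = 0#
  Σ< (suc n) φ = φ 0 + Σ< n (λ i → φ (suc i))

  Σ<-cong : ∀ n {φ ψ : ℕ → Carrier} → (∀ {i} → i < n → φ i ≈ ψ i) → Σ< n φ ≈ Σ< n ψ
  Σ<-cong zero    φ≈ψ = refl
  Σ<-cong (suc n) φ≈ψ = +-cong (φ≈ψ z<s) (Σ<-cong n (λ i<n → φ≈ψ (s≤s i<n)))

  Σ<-snoc : ∀ n (φ : ℕ → Carrier) → Σ< (suc n) φ ≈ Σ< n φ + φ n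
  Σ<-snoc zero    φ = trans (+-identityʳ _) (sym (+-identityˡ _))
  Σ<-snoc (suc n) φ = trans (+-congˡ (Σ<-snoc n (λ i → φ (suc i)))) (sym (+-assoc _ _ _))

  Σ<-reverse : ∀ n (φ : ℕ → Carrier) → Σ< n φ ≈ Σ< n (λ i → φ (n ∸ suc i))
  Σ<-reverse zero    φ = refl
  Σ<-reverse (suc n) φ = begin
    Σ< (suc n) φ                          ≈⟨ Σ<-snoc n φ ⟩
    Σ< n φ + φ n                          ≈⟨ +-congʳ (Σ<-reverse n φ) ⟩
    Σ< n (λ i → φ (n ∸ suc i)) + φ n      ≈⟨ +-comm _ _ ⟩
    Σ< (suc n) (λ i → φ (suc n ∸ suc i))  ∎

  Σ<-rotate : ∀ n (φ : ℕ → Carrier) → φ n ≈ φ 0 → Σ< n (λ i → φ (suc i)) ≈ Σ< n φ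
  Σ<-rotate n φ φn≈φ0 = +-cancelˡ (φ 0) _ _ (begin
    Σ< (suc n) φ   ≈⟨ Σ<-snoc n φ ⟩
    Σ< n φ + φ n   ≈⟨ +-congˡ φn≈φ0 ⟩
    Σ< n φ + φ 0   ≈⟨ +-comm _ _ ⟩
    φ 0 + Σ< n φ   ∎)

  -- Sums over Δ_k

  infixr 7 [_]·_
  [_]·_ : ∀ {p} {Q : Set p} → Dec Q → Carrier → Carrier
  [ yes _ ]· x = x
  [ no _  ]· x = 0#

  []·-cong : ∀ {p q} {P : Set p} {Q : Set q} (P? : Dec P) (Q? : Dec Q) →
             (P → Q) → (Q → P) → (P → x ≈ y) → [ P? ]· x ≈ [ Q? ]· y
  []·-cong (yes p) (yes _) P→Q Q→P x≈y = x≈y p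
  []·-cong (yes p) (no ¬q) P→Q Q→P x≈y = ⊥-elim (¬q (P→Q p))
  []·-cong (no ¬p) (yes q) P→Q Q→P x≈y = ⊥-elim (¬p (Q→P q))
  []·-cong (no _)  (no _)  P→Q Q→P x≈y = refl

  []·-congʳ : ∀ {p} {P : Set p} (P? : Dec P) → (P → x ≈ y) → [ P? ]· x ≈ [ P? ]· y
  []·-congʳ (yes p) x≈y = x≈y p
  []·-congʳ (no _)  x≈y = refl

  sumL-filter : ∀ {a p} {A : Set a} {P : Pred A p} (P? : Decidable P) (h : A → Carrier) xs →
                sumL (map h (filter P? xs)) ≈ sumL (map (λ x → [ P? x ]· h x) xs)
  sumL-filter P? h []       = refl
  sumL-filter P? h (x ∷ xs) with P? x
  ... | yes _ = +-congˡ (sumL-filter P? h xs)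
  ... | no _  = trans (sumL-filter P? h xs) (sym (+-identityˡ _))

  sumL-applyUpTo : ∀ (h : ℕ → Carrier) f n → sumL (map h (applyUpTo f n)) ≡ Σ< n (λ i → h (f i))
  sumL-applyUpTo h f zero    = ≡.refl
  sumL-applyUpTo h f (suc n) = ≡.cong (h (f 0) +_) (sumL-applyUpTo h (λ i → f (suc i)) n)

  sumL-scale : ∀ {a} {A : Set a} c (h : A → Carrier) xs → sumL (map (λ x → c * h x) xs) ≈ c * sumL (map h xs)
  sumL-scale c h []       = sym (zeroʳ c)
  sumL-scale c h (x ∷ xs) = trans (+-congˡ (sumL-scale c h xs)) (sym (distribˡ c _ _))

  Δ-summand : ℕ → Carrier → (Carrier → Carrier) → ℕ → Carrier
  Δ-summand k ζ h a = [ coprime? a k ]· h (pow ζ a)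

  sumΔ≈Σ< : ∀ k ζ h → sumΔ k ζ h ≈ Σ< k (λ i → Δ-summand k ζ h (suc i))
  sumΔ≈Σ< k ζ h = begin
    sumΔ k ζ h                                 ≈⟨ sumL-filter (λ a → coprime? a k) _ (map suc (upTo k)) ⟩
    sumL (map term (map suc (upTo k)))         ≡⟨ ≡.cong (λ as → sumL (map term as)) (List.map-upTo suc k) ⟩
    sumL (map term (applyUpTo suc k))          ≡⟨ sumL-applyUpTo term suc k ⟩
    Σ< k (λ i → term (suc i))                  ∎
    where
    term : ℕ → Carrier
    term = Δ-summand k ζ h

  sumΔ-cong : ∀ k ζ f g → (∀ a → Coprime a k → f (pow ζ a) ≈ g (pow ζ a)) → sumΔ k ζ f ≈ sumΔ k ζ g
  sumΔ-cong k ζ f g f≈g = begin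
    sumΔ k ζ f                               ≈⟨ sumΔ≈Σ< k ζ f ⟩
    Σ< k (λ i → Δ-summand k ζ f (suc i))     ≈⟨ Σ<-cong k (λ {i} _ → []·-congʳ (coprime? (suc i) k) (f≈g (suc i))) ⟩
    Σ< k (λ i → Δ-summand k ζ g (suc i))     ≈⟨ sumΔ≈Σ< k ζ g ⟨
    sumΔ k ζ g                               ∎

  sumΔ-scale : ∀ k ζ c h → sumΔ k ζ (λ η → c * h η) ≈ c * sumΔ k ζ h
  sumΔ-scale k ζ c h = sumL-scale c (λ a → h (pow ζ a)) (primExps k)

  coprime-∸ : a ≤ k → Coprime a k → Coprime (k ∸ a) k
  coprime-∸ {a} {k} a≤k a⊥k (d∣k∸a , d∣k) =
    a⊥k (∣m+n∣m⇒∣n (≡.subst (_ ∣_) (≡.sym (ℕ.m∸n+n≡m a≤k)) d∣k) d∣k∸a , d∣k)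

  coprime-∸⁻¹ : a ≤ k → Coprime (k ∸ a) k → Coprime a k
  coprime-∸⁻¹ {a} {k} a≤k k∸a⊥k =
    ≡.subst (λ b → Coprime b k) (ℕ.m∸[m∸n]≡n a≤k) (coprime-∸ (ℕ.m∸n≤m k a) k∸a⊥k)

  -- ζᵃ ↦ ζ^(k-a) reverses the exponents 1, …, k and preserves their coprimality to k.
  sumΔ-⁻¹ : ∀ k ζ (h : Carrier → Carrier) → (∀ {x y} → x ≈ y → h x ≈ h y) → pow ζ k ≈ 1# →
            sumΔ k ζ (λ η → h (η ⁻¹)) ≈ sumΔ k ζ h
  sumΔ-⁻¹ k ζ h h-cong ζᵏ≈1 = begin
    sumΔ k ζ (λ η → h (η ⁻¹))                                 ≈⟨ sumΔ≈Σ< k ζ (λ η → h (η ⁻¹)) ⟩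
    Σ< k (λ i → [ coprime? (suc i) k ]· h (pow ζ (suc i) ⁻¹)) ≈⟨ Σ<-cong k inverted-term ⟩
    Σ< k (λ i → term (k ∸ suc i))                             ≈⟨ Σ<-reverse k term ⟨
    Σ< k term                                                 ≈⟨ Σ<-rotate k term term-k≈term-0 ⟨
    Σ< k (λ i → term (suc i))                                 ≈⟨ sumΔ≈Σ< k ζ h ⟨
    sumΔ k ζ h                                                ∎
    where
    term : ℕ → Carrier
    term = Δ-summand k ζ h

    inverted-term : a < k → [ coprime? (suc a) k ]· h (pow ζ (suc a) ⁻¹) ≈ term (k ∸ suc a)
    inverted-term {a} a<k = []·-cong (coprime? (suc a) k) (coprime? (k ∸ suc a) k)
      (coprime-∸ a<k) (coprime-∸⁻¹ a<k) (λ _ → h-cong (⁻¹-unique (root-pow-complement ζᵏ≈1 a<k)))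

    term-k≈term-0 : term k ≈ term 0
    term-k≈term-0 = []·-cong (coprime? k k) (coprime? 0 k)
      (coprime-∸⁻¹ z≤n) (coprime-∸ z≤n) (λ _ → h-cong ζᵏ≈1)

  -- The product (η)_(k-1) for a primitive k-th root of unity η

  -- Encodes the monic polynomial xᵈ + a_(d-1) x^(d-1) + ⋯ + a₀ as [a₀, …, a_(d-1)].
  evalMonic : ∀ {d} → Vec Carrier d → Carrier → Carrier
  evalMonic []      x = 1#
  evalMonic (a ∷ p) x = a + x * evalMonic p x

  divideLinear : Carrier → ∀ {d} → Vec Carrier (suc d) → Vec Carrier d × Carrier
  divideLinear c (a ∷ [])    = [] , a + c
  divideLinear c (a ∷ b ∷ p) =
    let q , r = divideLinear c (b ∷ p) in r ∷ q , a + c * r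

  quotient : Carrier → ∀ {d} → Vec Carrier (suc d) → Vec Carrier d
  quotient c p = proj₁ (divideLinear c p)

  remainder : Carrier → ∀ {d} → Vec Carrier (suc d) → Carrier
  remainder c p = proj₂ (divideLinear c p)

  divideLinear-correct : ∀ c {d} (p : Vec Carrier (suc d)) x →
                         evalMonic p x ≈ (x - c) * evalMonic (quotient c p) x + remainder c p
  divideLinear-correct c (a ∷ []) x = begin
    a + x * 1#                  ≈⟨ +-congˡ (trans (*-identityʳ x) (sym (//-rightDividesˡ c x))) ⟩
    a + ((x - c) + c)           ≈⟨ linear-division-base a (x - c) c ⟩
    (x - c) + (a + c)           ≈⟨ +-congʳ (*-identityʳ _) ⟨
    (x - c) * 1# + (a + c)      ∎
  divideLinear-correct c (a ∷ b ∷ p) x = begin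
    a + x * evalMonic (b ∷ p) x                      ≈⟨ +-congˡ (*-congˡ (divideLinear-correct c (b ∷ p) x)) ⟩
    a + x * ((x - c) * q + r)                        ≈⟨ +-congˡ (*-congʳ x≈[x-c]+c) ⟩
    a + ((x - c) + c) * ((x - c) * q + r)            ≈⟨ linear-division-step a (x - c) c q r ⟩
    (x - c) * (r + ((x - c) + c) * q) + (a + c * r)  ≈⟨ +-congʳ (*-congˡ (+-congˡ (*-congʳ x≈[x-c]+c))) ⟨
    (x - c) * (r + x * q) + (a + c * r)              ∎
    where
    q r : Carrier
    q = evalMonic (quotient c (b ∷ p)) x
    r = remainder c (b ∷ p)
    x≈[x-c]+c : x ≈ (x - c) + c
    x≈[x-c]+c = sym (//-rightDividesˡ c x)

  factor-theorem : ∀ {d} (p : Vec Carrier (suc d)) {c} → evalMonic p c ≈ 0# →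
                   ∀ x → evalMonic p x ≈ (x - c) * evalMonic (quotient c p) x
  factor-theorem p {c} pc≈0 x = begin
    evalMonic p x                                          ≈⟨ divideLinear-correct c p x ⟩
    (x - c) * evalMonic (quotient c p) x + remainder c p   ≈⟨ +-congˡ r≈0 ⟩
    (x - c) * evalMonic (quotient c p) x + 0#              ≈⟨ +-identityʳ _ ⟩
    (x - c) * evalMonic (quotient c p) x                   ∎
    where
    r≈0 : remainder c p ≈ 0#
    r≈0 = begin
      remainder c p                                        ≈⟨ +-identityˡ _ ⟨
      0# + remainder c p                                   ≈⟨ +-congʳ (zeroˡ _) ⟨
      0# * evalMonic (quotient c p) c + remainder c p      ≈⟨ +-congʳ (*-congʳ (-‿inverseʳ c)) ⟨
      (c - c) * evalMonic (quotient c p) c + remainder c p ≈⟨ divideLinear-correct c p c ⟨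
      evalMonic p c                                        ≈⟨ pc≈0 ⟩
      0#                                                   ∎

  monic-roots-product : ∀ {d} (p : Vec Carrier d) (c : ℕ → Carrier) →
                        (∀ {i j} → i < j → j < d → ¬ c i ≈ c j) →
                        (∀ {i} → i < d → evalMonic p (c i) ≈ 0#) →
                        ∀ x → evalMonic p x ≈ ∏< d (λ i → x - c i)
  monic-roots-product []               c distinct roots x = refl
  monic-roots-product {suc d} p@(_ ∷ _) c distinct roots x = begin
    evalMonic p x                     ≈⟨ divides x ⟩
    (x - c d) * evalMonic q x         ≈⟨ *-congˡ (monic-roots-product q c distinct′ roots′ x) ⟩
    (x - c d) * ∏< d (λ i → x - c i)  ≈⟨ *-comm _ _ ⟩
    ∏< (suc d) (λ i → x - c i)        ∎
    where
    q : Vec Carrier d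
    q = quotient (c d) p
    divides : ∀ x → evalMonic p x ≈ (x - c d) * evalMonic q x
    divides = factor-theorem p (roots (ℕ.n<1+n d))
    distinct′ : ∀ {i j} → i < j → j < d → ¬ c i ≈ c j
    distinct′ i<j j<d = distinct i<j (ℕ.m<n⇒m<1+n j<d)
    roots′ : ∀ {i} → i < d → evalMonic q (c i) ≈ 0#
    roots′ {i} i<d = *≈0⇒≈0 (-≉0 (distinct i<d (ℕ.n<1+n d)))
      (trans (sym (divides (c i))) (roots (ℕ.m<n⇒m<1+n i<d)))

  geometric-sum : ∀ n y → evalMonic (replicate n 1#) y * y + 1# ≈ evalMonic (replicate n 1#) y + pow y (suc n)
  geometric-sum zero    y = geometric-base y 1#
  geometric-sum (suc n) y = begin
    (1# + y * e) * y + 1#               ≈⟨ geometric-step₁ y e 1# ⟩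
    1# + y * (e * y + 1#)               ≈⟨ +-congˡ (*-congˡ (geometric-sum n y)) ⟩
    1# + y * (e + pow y (suc n))        ≈⟨ geometric-step₂ y e (pow y (suc n)) 1# ⟩
    (1# + y * e) + pow y (suc (suc n))  ∎
    where
    e : Carrier
    e = evalMonic (replicate n 1#) y

  geometric-sum-root : ∀ n → pow y (suc n) ≈ 1# → ¬ y ≈ 1# → evalMonic (replicate n 1#) y ≈ 0#
  geometric-sum-root {y} n yⁿ⁺¹≈1 y≉1 = *≈0⇒≈0 (-≉0 y≉1) (trans (*-comm _ _) e[y-1]≈0)
    where
    e : Carrier
    e = evalMonic (replicate n 1#) y
    ey≈e1 : e * y ≈ e * 1#
    ey≈e1 = +-cancelʳ 1# _ _ (begin
      e * y + 1#         ≈⟨ geometric-sum n y ⟩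
      e + pow y (suc n)  ≈⟨ +-cong (sym (*-identityʳ e)) yⁿ⁺¹≈1 ⟩
      e * 1# + 1#        ∎)
    e[y-1]≈0 : e * (y - 1#) ≈ 0#
    e[y-1]≈0 = trans (x[y-z]≈xy-xz e y 1#) (x≈y⇒x∙y⁻¹≈ε ey≈e1)

  geometric-sum-at-1 : ∀ n → evalMonic (replicate n 1#) 1# ≈ fromℕ (suc n)
  geometric-sum-at-1 zero    = sym (+-identityʳ 1#)
  geometric-sum-at-1 (suc n) = +-congˡ (trans (*-identityˡ _) (geometric-sum-at-1 n))

  poch-primitive : IsPrimitiveRoot (suc K) η → poch η K ≈ fromℕ (suc K)
  poch-primitive {K} {η} η-prim@(ηᵏ≈1 , minimal) = begin
    poch η K                                 ≡⟨ poch≡∏< η K ⟩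
    ∏< K (λ i → 1# - pow η (suc i))          ≈⟨ monic-roots-product (replicate K 1#) root distinct vanishes 1# ⟨
    evalMonic (replicate K 1#) 1#            ≈⟨ geometric-sum-at-1 K ⟩
    fromℕ (suc K)                            ∎
    where
    root : ℕ → Carrier
    root i = pow η (suc i)
    distinct : ∀ {i j} → i < j → j < K → ¬ root i ≈ root j
    distinct i<j j<K = primitive-pow-injective η-prim (s≤s i<j) (s≤s j<K)
    vanishes : ∀ {i} → i < K → evalMonic (replicate K 1#) (root i) ≈ 0#
    vanishes {i} i<K = geometric-sum-root K (root-pow {η} {suc K} ηᵏ≈1 (suc i)) (minimal (suc i) z<s (s≤s i<K))

  -- The summand ηᵗ / (η)_j in terms of η⁻¹

  pow-inverse-complement : η * η′ ≈ 1# → pow η k ≈ 1# → i ℕ.+ m ≡ k → pow η′ m ≈ pow η i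
  pow-inverse-complement {η} {η′} {k} {i} {m} ηη′≈1 ηᵏ≈1 i+m≡k = begin
    pow η′ m                        ≈⟨ *-identityʳ _ ⟨
    pow η′ m * 1#                   ≈⟨ *-congˡ ηᵏ≈1 ⟨
    pow η′ m * pow η k              ≡⟨ ≡.cong (λ n → pow η′ m * pow η n) (≡.trans (≡.sym i+m≡k) (ℕ.+-comm i m)) ⟩
    pow η′ m * pow η (m ℕ.+ i)      ≈⟨ *-congˡ (pow-+ η m i) ⟩
    pow η′ m * (pow η m * pow η i)  ≈⟨ *-assoc _ _ _ ⟨
    pow η′ m * pow η m * pow η i    ≈⟨ *-congʳ (sym (pow-distrib-* η′ η m)) ⟩
    pow (η′ * η) m * pow η i        ≈⟨ *-congʳ (trans (pow-cong m (trans (*-comm η′ η) ηη′≈1)) (pow-1# m)) ⟩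
    1# * pow η i                    ≈⟨ *-identityˡ _ ⟩
    pow η i                         ∎

  -- Each factor 1 - η^(j+1+i) of (η)_(j+n) beyond (η)_j equals 1 - η′^(n-i).
  poch-split : η * η′ ≈ 1# → pow η (suc K) ≈ 1# → ∀ n j → j ℕ.+ n ≡ K →
               poch η (j ℕ.+ n) ≈ poch η j * poch η′ n
  poch-split {η} {η′} {K} ηη′≈1 ηᵏ≈1 zero j j+0≡K =
    ≡.subst (λ m → poch η m ≈ poch η j * 1#) (≡.sym (ℕ.+-identityʳ j)) (sym (*-identityʳ _))
  poch-split {η} {η′} {K} ηη′≈1 ηᵏ≈1 (suc n) j j+1+n≡K = begin
    poch η (j ℕ.+ suc n)                                ≡⟨ ≡.cong (poch η) (ℕ.+-suc j n) ⟩
    poch η (suc j ℕ.+ n)                                ≈⟨ poch-split ηη′≈1 ηᵏ≈1 n (suc j) (≡.trans (≡.sym (ℕ.+-suc j n)) j+1+n≡K) ⟩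
    poch η j * (1# - pow η (suc j)) * poch η′ n         ≈⟨ *-congʳ (*-congˡ (+-congˡ (-‿cong (sym η′ⁿ⁺¹≈ηʲ⁺¹)))) ⟩
    poch η j * (1# - pow η′ (suc n)) * poch η′ n        ≈⟨ *-assoc _ _ _ ⟩
    poch η j * ((1# - pow η′ (suc n)) * poch η′ n)      ≈⟨ *-congˡ (*-comm _ _) ⟩
    poch η j * poch η′ (suc n)                          ∎
    where
    η′ⁿ⁺¹≈ηʲ⁺¹ : pow η′ (suc n) ≈ pow η (suc j)
    η′ⁿ⁺¹≈ηʲ⁺¹ = pow-inverse-complement {i = suc j} {m = suc n} ηη′≈1 ηᵏ≈1 (≡.cong suc j+1+n≡K)

  primitive-summand : IsPrimitiveRoot (suc K) η → j ≤ K → ∀ t →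
                      powℤ η t * (poch η j ⁻¹)
                        ≈ (fromℕ (suc K) ⁻¹) * (powℤ (η ⁻¹) (ℤ.- t) * poch (η ⁻¹) (K ∸ j))
  primitive-summand {K} {η} {j} η-prim j≤K t = begin
    powℤ η t * (poch η j ⁻¹)                             ≈⟨ *-cong (powℤ-⁻¹ η≉0 t) (⁻¹-unique pochs≈1) ⟩
    powℤ (η ⁻¹) (ℤ.- t) * (poch (η ⁻¹) (K ∸ j) * k⁻¹)    ≈⟨ *-assoc _ _ _ ⟨
    powℤ (η ⁻¹) (ℤ.- t) * poch (η ⁻¹) (K ∸ j) * k⁻¹      ≈⟨ *-comm _ _ ⟩
    k⁻¹ * (powℤ (η ⁻¹) (ℤ.- t) * poch (η ⁻¹) (K ∸ j))    ∎
    where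
    k⁻¹ : Carrier
    k⁻¹ = fromℕ (suc K) ⁻¹
    η≉0 : ¬ η ≈ 0#
    η≉0 = *≈1⇒≉0 (proj₁ η-prim)
    pochs≈1 : poch η j * (poch (η ⁻¹) (K ∸ j) * k⁻¹) ≈ 1#
    pochs≈1 = begin
      poch η j * (poch (η ⁻¹) (K ∸ j) * k⁻¹)  ≈⟨ *-assoc _ _ _ ⟨
      poch η j * poch (η ⁻¹) (K ∸ j) * k⁻¹    ≈⟨ *-congʳ (poch-split (inverse η η≉0) (proj₁ η-prim) (K ∸ j) j (ℕ.m+[n∸m]≡n j≤K)) ⟨
      poch η (j ℕ.+ (K ∸ j)) * k⁻¹            ≡⟨ ≡.cong (λ m → poch η m * k⁻¹) (ℕ.m+[n∸m]≡n j≤K) ⟩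
      poch η K * k⁻¹                          ≈⟨ *-congʳ (poch-primitive η-prim) ⟩
      fromℕ (suc K) * k⁻¹                     ≈⟨ inverse (fromℕ (suc K)) (char0 K) ⟩
      1#                                      ∎

  powℤ*poch-cong : ∀ t n → x ≈ y → powℤ x t * poch x n ≈ powℤ y t * poch y n
  powℤ*poch-cong t n x≈y = *-cong (powℤ-cong t x≈y) (poch-cong n x≈y)

mainTheorem12 : ∀ {c ℓ} (F : Char0Field c ℓ) → let open FieldOps F in
    (k : ℕ) → 1 ≤ k → (j : ℕ) → j < k → (t : ℤ) →
    (ζ : Carrier) → IsPrimitiveRoot k ζ →
    sumΔ k ζ (λ η → powℤ η t * (poch η j ⁻¹))
      ≈ (fromℕ k ⁻¹) * σ k ζ t (k ∸ 1 ∸ j)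
mainTheorem12 F (suc K) _ j (s≤s j≤K) t ζ ζ-prim = begin
  sumΔ k ζ f                       ≈⟨ sumΔ-cong k ζ f (λ η → k⁻¹ * g (η ⁻¹)) f≈k⁻¹g⁻¹ ⟩
  sumΔ k ζ (λ η → k⁻¹ * g (η ⁻¹))  ≈⟨ sumΔ-scale k ζ k⁻¹ (λ η → g (η ⁻¹)) ⟩
  k⁻¹ * sumΔ k ζ (λ η → g (η ⁻¹))  ≈⟨ *-congˡ (sumΔ-⁻¹ k ζ g (powℤ*poch-cong (ℤ.- t) (K ∸ j)) (proj₁ ζ-prim)) ⟩
  k⁻¹ * σ k ζ t (K ∸ j)            ∎
  where
  open FieldOps F
  open Cyclotomic F
  open import Relation.Binary.Reasoning.Setoid setoid
  k : ℕ
  k = suc K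
  k⁻¹ : Carrier
  k⁻¹ = fromℕ k ⁻¹
  f g : Carrier → Carrier
  f η = powℤ η t * (poch η j ⁻¹)
  g ξ = powℤ ξ (ℤ.- t) * poch ξ (K ∸ j)
  f≈k⁻¹g⁻¹ : ∀ a → Coprime a k → f (pow ζ a) ≈ k⁻¹ * g (pow ζ a ⁻¹)
  f≈k⁻¹g⁻¹ a a⊥k = primitive-summand (coprime-pow-primitive ζ-prim a⊥k) j≤K t
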